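{- Let $\mathcal{M}\models\mathrm{I}\Delta_0$ and let $j$ be a nontrivial self-embedding of $\mathcal{M}$ such that $j(\mathcal{M})\preceq_{\Delta_0}\mathcal{M}$. Then $\mathrm{I}_{\mathrm{fix}}(j)$, regarded as a substructure of $\mathcal{M}$, satisfies $\mathrm{I}\Delta_0+\mathrm{B}\Sigma_1+\mathrm{Exp}$.
   Context: $\mathrm{I}\Delta_0$ is Peano Arithmetic with induction restricted to bounded formulae. $\mathrm{B}\Sigma_1$ is the $\Sigma_1$-collection scheme: the universal closures of $[\forall x<v\,\exists y\,\varphi(x,y)]\to\exists z\,[\forall x<v\,\exists y<z\,\varphi(x,y)]$ for $\Sigma_1$-formulae $\varphi$ (with parameters). $\mathrm{Exp}$ is $\forall x\exists y\,\mathrm{Exp}(x,y)$, where $\mathrm{Exp}(x,y)$ is the standard $\Delta_0$-formula expressing $y=2^x$. A self-embedding of $\mathcal{M}$ is an isomorphism between $\mathcal{M}$ and a submodel of $\mathcal{M}$; it is nontrivial if it is not the identity. $j(\mathcal{M})\preceq_{\Delta_0}\mathcal{M}$ means $\Delta_0$-formulae with parameters in $j(M)$ are absolute between $j(\mathcal{M})$ and $\mathcal{M}$. $\mathrm{I}_{\mathrm{fix}}(j):=\{m\in M:\forall x\le m\ j(x)=x\}$. -}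

module Defs where

open import Data.Nat using (ℕ; zero; suc)
open import Data.Fin using (Fin)
import Data.Fin as F
open import Data.Vec.Functional using (Vector; _∷_; [])
open import Data.Product using (Σ; _×_; _,_)
open import Data.Sum using (_⊎_)
open import Data.Unit using (⊤)
open import Data.Empty using (⊥)
open import Relation.Nullary using (¬_)
open import Relation.Binary.PropositionalEquality using (_≡_; _≢_)

-- Syntax (de Bruijn variables; variable 0 is the most recently bound)

infixl 7 _⊗_
infixl 6 _⊕_
infix 4 _≐_ _≺_
infixr 3 _∧'_
infixr 2 _∨'_
infixr 1 _⇒'_

data Tm (n : ℕ) : Set where
  var     : Fin n → Tm n
  𝟎 𝟏     : Tm n
  _⊕_ _⊗_ : Tm n → Tm n → Tm n

data Fm (n : ℕ) : Set where
  _≐_ _≺_        : Tm n → Tm n → Fm n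
  ⊥'             : Fm n
  ¬'             : Fm n → Fm n
  _∧'_ _∨'_ _⇒'_ : Fm n → Fm n → Fm n
  ∀' ∃'          : Fm (suc n) → Fm n
  -- bounded quantifiers:  ∀< t φ  is  ∀x < t φ(x),  ∃< t φ  is  ∃x < t φ(x)
  -- (t lives in the outer context, so x does not occur in t)
  ∀< ∃<          : Tm n → Fm (suc n) → Fm n

data IsΔ0 {n : ℕ} : Fm n → Set where
  atEq : ∀ s t → IsΔ0 (s ≐ t)
  atLt : ∀ s t → IsΔ0 (s ≺ t)
  bot : IsΔ0 ⊥'
  neg : ∀ {φ} → IsΔ0 φ → IsΔ0 (¬' φ)
  and : ∀ {φ ψ} → IsΔ0 φ → IsΔ0 ψ → IsΔ0 (φ ∧' ψ)
  or  : ∀ {φ ψ} → IsΔ0 φ → IsΔ0 ψ → IsΔ0 (φ ∨' ψ)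
  imp : ∀ {φ ψ} → IsΔ0 φ → IsΔ0 ψ → IsΔ0 (φ ⇒' ψ)
  ball : ∀ t {φ} → IsΔ0 φ → IsΔ0 (∀< t φ)
  bex  : ∀ t {φ} → IsΔ0 φ → IsΔ0 (∃< t φ)

data IsΣ1 {n : ℕ} : Fm n → Set where
  δ0 : ∀ {φ} → IsΔ0 φ → IsΣ1 φ
  ex : ∀ {φ} → IsΣ1 φ → IsΣ1 (∃' φ)

-- Structures for the language {0,1,+,·,<}; equality is interpreted as ≡

record Str : Set₁ where
  field
    C   : Set
    z o : C
    add mul : C → C → C
    lt  : C → C → Set

module _ (M : Str) where
  open Str M

  le : C → C → Set
  le x y = lt x y ⊎ x ≡ y

  ⟦_⟧ : ∀ {n} → Tm n → Vector C n → C
  ⟦ var i ⟧ ρ = ρ i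
  ⟦ 𝟎 ⟧ ρ = z
  ⟦ 𝟏 ⟧ ρ = o
  ⟦ s ⊕ t ⟧ ρ = add (⟦ s ⟧ ρ) (⟦ t ⟧ ρ)
  ⟦ s ⊗ t ⟧ ρ = mul (⟦ s ⟧ ρ) (⟦ t ⟧ ρ)

  -- When D is closed under 0,1,+,· this is satisfaction in the
  -- substructure of M with universe D; for D = everything it is M ⊨ φ[ρ].
  Sat : (D : C → Set) → ∀ {n} → Fm n → Vector C n → Set
  Sat D (s ≐ t) ρ = ⟦ s ⟧ ρ ≡ ⟦ t ⟧ ρ
  Sat D (s ≺ t) ρ = lt (⟦ s ⟧ ρ) (⟦ t ⟧ ρ)
  Sat D ⊥' ρ = ⊥
  Sat D (¬' φ) ρ = ¬ Sat D φ ρ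
  Sat D (φ ∧' ψ) ρ = Sat D φ ρ × Sat D ψ ρ
  Sat D (φ ∨' ψ) ρ = Sat D φ ρ ⊎ Sat D ψ ρ
  Sat D (φ ⇒' ψ) ρ = Sat D φ ρ → Sat D ψ ρ
  Sat D (∀' φ) ρ = (x : C) → D x → Sat D φ (x ∷ ρ)
  Sat D (∃' φ) ρ = Σ C λ x → D x × Sat D φ (x ∷ ρ)
  Sat D (∀< t φ) ρ = (x : C) → D x → lt x (⟦ t ⟧ ρ) → Sat D φ (x ∷ ρ)
  Sat D (∃< t φ) ρ = Σ C λ x → D x × lt x (⟦ t ⟧ ρ) × Sat D φ (x ∷ ρ)

  All : C → Set
  All _ = ⊤

  InD : (D : C → Set) → ∀ {n} → Vector C n → Set
  InD D ρ = ∀ i → D (ρ i)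

  Closed : (C → Set) → Set
  Closed D = D z × D o × (∀ x y → D x → D y → D (add x y) × D (mul x y))

  PAminus : (C → Set) → Set
  PAminus D =
      (∀ x y w → D x → D y → D w → add (add x y) w ≡ add x (add y w))
    × (∀ x y → D x → D y → add x y ≡ add y x)
    × (∀ x y w → D x → D y → D w → mul (mul x y) w ≡ mul x (mul y w))
    × (∀ x y → D x → D y → mul x y ≡ mul y x)
    × (∀ x y w → D x → D y → D w → mul x (add y w) ≡ add (mul x y) (mul x w))
    × (∀ x → D x → add x z ≡ x × mul x z ≡ z)
    × (∀ x → D x → mul x o ≡ x)
    × (∀ x y w → D x → D y → D w → lt x y → lt y w → lt x w)
    × (∀ x → D x → ¬ lt x x)
    × (∀ x y → D x → D y → lt x y ⊎ x ≡ y ⊎ lt y x)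
    × (∀ x y w → D x → D y → D w → lt x y → lt (add x w) (add y w))
    × (∀ x y w → D x → D y → D w → lt z w → lt x y → lt (mul x w) (mul y w))
    × (∀ x y → D x → D y → lt x y → Σ C λ w → D w × add x w ≡ y)
    × lt z o × (∀ x → D x → lt z x → le o x)
    × (∀ x → D x → le z x)

  IndΔ0 : (C → Set) → Set
  IndΔ0 D = ∀ {n} (φ : Fm (suc n)) → IsΔ0 φ → (ρ : Vector C n) → InD D ρ →
    Sat D φ (z ∷ ρ) →
    ((x : C) → D x → Sat D φ (x ∷ ρ) → Sat D φ (add x o ∷ ρ)) →
    (x : C) → D x → Sat D φ (x ∷ ρ)

  IΔ0 : (C → Set) → Set
  IΔ0 D = PAminus D × IndΔ0 D

  -- Σ1-collection, relativised to D.  In φ, variable 0 is y, variable 1 is x.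
  BΣ1 : (C → Set) → Set
  BΣ1 D = ∀ {n} (φ : Fm (suc (suc n))) → IsΣ1 φ → (ρ : Vector C n) → InD D ρ →
    (v : C) → D v →
    ((x : C) → D x → lt x v → Σ C λ y → D y × Sat D φ (y ∷ x ∷ ρ)) →
    Σ C λ w → D w × ((x : C) → D x → lt x v →
                      Σ C λ y → D y × lt y w × Sat D φ (y ∷ x ∷ ρ))

  -- the axiom Exp, ∀x ∃y E(x,y), relativised to D
  -- (for E : Fm 2, variable 0 is x and variable 1 is y)
  ExpAx : Fm 2 → (C → Set) → Set
  ExpAx E D = (x : C) → D x → Σ C λ y → D y × Sat D E (x ∷ y ∷ [])

-- "The standard Δ0 formula Exp(x,y) expressing y = 2^x":  we accept any Δ0
-- formula that, in every model of IΔ0, satisfies the recursion equations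
--   E(0,y) ↔ y = 1,     E(x+1,y) ↔ ∃w ≤ y (E(x,w) ∧ y = w+w).
-- Any two such formulae are IΔ0-provably equivalent, and the
-- standard one is of this kind.

IsExpFormula : Fm 2 → Set₁
IsExpFormula E = IsΔ0 E × ((N : Str) → IΔ0 N (All N) →
    let open Str N in
      ((y : C) → (Sat N (All N) E (z ∷ y ∷ []) → y ≡ o)
               × (y ≡ o → Sat N (All N) E (z ∷ y ∷ [])))
    × ((x y : C) →
         (Sat N (All N) E (add x o ∷ y ∷ []) →
            Σ C λ w → le N w y × Sat N (All N) E (x ∷ w ∷ []) × y ≡ add w w)
       × ((Σ C λ w → le N w y × Sat N (All N) E (x ∷ w ∷ []) × y ≡ add w w) →
            Sat N (All N) E (add x o ∷ y ∷ []))))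

module _ (M : Str) where
  open Str M

  record SelfEmbedding (j : C → C) : Set where
    field
      injective : ∀ x y → j x ≡ j y → x ≡ y
      pres-z    : j z ≡ z
      pres-o    : j o ≡ o
      pres-add  : ∀ x y → j (add x y) ≡ add (j x) (j y)
      pres-mul  : ∀ x y → j (mul x y) ≡ mul (j x) (j y)
      pres-lt   : ∀ x y → lt x y → lt (j x) (j y)
      refl-lt   : ∀ x y → lt (j x) (j y) → lt x y

  Nontrivial : (C → C) → Set
  Nontrivial j = Σ C λ x → j x ≢ x

  Image : (C → C) → C → Set
  Image j m = Σ C λ x → j x ≡ m

  Δ0Elementary : (C → C) → Set
  Δ0Elementary j = ∀ {n} (φ : Fm n) → IsΔ0 φ → (ρ : Vector C n) →
    InD M (Image j) ρ →
    (Sat M (Image j) φ ρ → Sat M (All M) φ ρ) × (Sat M (All M) φ ρ → Sat M (Image j) φ ρ)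

  Ifix : (C → C) → C → Set
  Ifix j m = (x : C) → le M x m → j x ≡ x

-- classical logic (the model theory is classical)
LEM : Set₁
LEM = (P : Set) → P ⊎ ¬ P

{-# OPTIONS --safe #-}
module Submission where

open import Defs
open import Data.Nat using (ℕ; suc)
open import Data.Fin using (Fin; zero; suc; lift; #_)
open import Data.Vec.Functional using (Vector; _∷_; [])
open import Data.Product using (Σ; _×_; _,_; proj₁; proj₂)
open import Data.Sum using (_⊎_; inj₁; inj₂)
open import Data.Unit using (⊤; tt)
open import Data.Empty using (⊥-elim)
open import Function using (_∘_)
open import Relation.Nullary using (¬_)
open import Relation.Binary.PropositionalEquality
open import Relation.Binary.Definitions using (Transitive)
open import Relation.Binary.Bundles using (StrictPartialOrder)
import Relation.Binary.Construct.StrictToNonStrict as StrictToNonStrict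
import Relation.Binary.Properties.StrictPartialOrder as StrictPartialOrderProperties
import Relation.Binary.Reasoning.StrictPartialOrder as StrictPartialOrderReasoning

-- I_fix(j) is an initial segment of M closed under + and · (for ·, write u = q·a + r and use
-- that j commutes with division by a fixed a), and it is proper because j moves some element.
-- Δ0 formulae are absolute between such a cut and M, so the cut inherits PA⁻ and Δ0 induction;
-- BΣ1 follows by overspill, since bounding all witnesses of a collection instance by a single
-- element c turns it into a Δ0 property of c.
-- For Exp, fix x with j x ≠ x.  As j(M) ≼Δ0 M and E is functional, j fixes 2^k whenever it
-- fixes k, so j commutes with division by 2^k; Δ0 induction on k ≤ m ∈ I_fix then gives
-- x ≡ j x (mod 2^k), so in particular 2^m exists.  And 2^m ∈ I_fix: a y ≤ 2^m moved by j would
-- satisfy y ≡ j y (mod 2^(m+1)), whence 2^(m+1) ≤ y + j y < 2^(m+1).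

renᵗ : ∀ {n m} → (Fin n → Fin m) → Tm n → Tm m
renᵗ f (var i) = var (f i)
renᵗ f 𝟎 = 𝟎
renᵗ f 𝟏 = 𝟏
renᵗ f (s ⊕ t) = renᵗ f s ⊕ renᵗ f t
renᵗ f (s ⊗ t) = renᵗ f s ⊗ renᵗ f t

ren : ∀ {n m} → (Fin n → Fin m) → Fm n → Fm m
ren f (s ≐ t) = renᵗ f s ≐ renᵗ f t
ren f (s ≺ t) = renᵗ f s ≺ renᵗ f t
ren f ⊥' = ⊥'
ren f (¬' φ) = ¬' (ren f φ)
ren f (φ ∧' ψ) = ren f φ ∧' ren f ψ
ren f (φ ∨' ψ) = ren f φ ∨' ren f ψ
ren f (φ ⇒' ψ) = ren f φ ⇒' ren f ψ
ren f (∀' φ) = ∀' (ren (lift 1 f) φ)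
ren f (∃' φ) = ∃' (ren (lift 1 f) φ)
ren f (∀< t φ) = ∀< (renᵗ f t) (ren (lift 1 f) φ)
ren f (∃< t φ) = ∃< (renᵗ f t) (ren (lift 1 f) φ)

ren-Δ0 : ∀ {n m} (f : Fin n → Fin m) {φ : Fm n} → IsΔ0 φ → IsΔ0 (ren f φ)
ren-Δ0 f (atEq s t) = atEq _ _
ren-Δ0 f (atLt s t) = atLt _ _
ren-Δ0 f bot = bot
ren-Δ0 f (neg p) = neg (ren-Δ0 f p)
ren-Δ0 f (and p q) = and (ren-Δ0 f p) (ren-Δ0 f q)
ren-Δ0 f (or p q) = or (ren-Δ0 f p) (ren-Δ0 f q)
ren-Δ0 f (imp p q) = imp (ren-Δ0 f p) (ren-Δ0 f q)
ren-Δ0 f (ball t p) = ball _ (ren-Δ0 (lift 1 f) p)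
ren-Δ0 f (bex t p) = bex _ (ren-Δ0 (lift 1 f) p)

boundedRen : ∀ {n m} → (Fin n → Fin m) → {φ : Fm n} → IsΣ1 φ → Tm m → Fm m
boundedRen f (δ0 {φ} _) t = ren f φ
boundedRen f (ex s) t = ∃< t (boundedRen (lift 1 f) s (renᵗ suc t))

boundedRen-Δ0 : ∀ {n m} (f : Fin n → Fin m) {φ : Fm n} (s : IsΣ1 φ) (t : Tm m) →
  IsΔ0 (boundedRen f s t)
boundedRen-Δ0 f (δ0 h) t = ren-Δ0 f h
boundedRen-Δ0 f (ex s) t = bex t (boundedRen-Δ0 (lift 1 f) s (renᵗ suc t))

record IsCut (M : Str) (D : Str.C M → Set) : Set where
  field
    closed : Closed M D
    down   : ∀ {x y} → le M x y → D y → D x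

module Semantics (M : Str) where
  open Str M

  InD-∷ : ∀ (D : C → Set) {n x} {ρ : Vector C n} → D x → InD M D ρ → InD M D (x ∷ ρ)
  InD-∷ D dx dρ zero = dx
  InD-∷ D dx dρ (suc i) = dρ i

  ∷-lift : ∀ {n m} {f : Fin n → Fin m} {σ τ} (x : C) → σ ∘ f ≗ τ → (x ∷ σ) ∘ lift 1 f ≗ (x ∷ τ)
  ∷-lift x e zero = refl
  ∷-lift x e (suc i) = e i

  ⟦⟧-ren : ∀ {n m} (f : Fin n → Fin m) (t : Tm n) {σ τ} → σ ∘ f ≗ τ →
    ⟦ M ⟧ (renᵗ f t) σ ≡ ⟦ M ⟧ t τ
  ⟦⟧-ren f (var i) e = e i
  ⟦⟧-ren f 𝟎 e = refl
  ⟦⟧-ren f 𝟏 e = refl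
  ⟦⟧-ren f (s ⊕ t) e = cong₂ add (⟦⟧-ren f s e) (⟦⟧-ren f t e)
  ⟦⟧-ren f (s ⊗ t) e = cong₂ mul (⟦⟧-ren f s e) (⟦⟧-ren f t e)

  ⟦⟧-weaken : ∀ {n} (t : Tm n) {x σ} → ⟦ M ⟧ (renᵗ suc t) (x ∷ σ) ≡ ⟦ M ⟧ t σ
  ⟦⟧-weaken t = ⟦⟧-ren suc t λ _ → refl

  Sat-ren⁺ : ∀ D {n m} (f : Fin n → Fin m) (φ : Fm n) {σ τ} → σ ∘ f ≗ τ →
    Sat M D φ τ → Sat M D (ren f φ) σ
  Sat-ren⁻ : ∀ D {n m} (f : Fin n → Fin m) (φ : Fm n) {σ τ} → σ ∘ f ≗ τ →
    Sat M D (ren f φ) σ → Sat M D φ τ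
  Sat-ren⁺ D f (s ≐ t) e p = trans (⟦⟧-ren f s e) (trans p (sym (⟦⟧-ren f t e)))
  Sat-ren⁺ D f (s ≺ t) e p = subst₂ lt (sym (⟦⟧-ren f s e)) (sym (⟦⟧-ren f t e)) p
  Sat-ren⁺ D f ⊥' e p = p
  Sat-ren⁺ D f (¬' φ) e p = λ q → p (Sat-ren⁻ D f φ e q)
  Sat-ren⁺ D f (φ ∧' ψ) e (p , q) = Sat-ren⁺ D f φ e p , Sat-ren⁺ D f ψ e q
  Sat-ren⁺ D f (φ ∨' ψ) e (inj₁ p) = inj₁ (Sat-ren⁺ D f φ e p)
  Sat-ren⁺ D f (φ ∨' ψ) e (inj₂ q) = inj₂ (Sat-ren⁺ D f ψ e q)
  Sat-ren⁺ D f (φ ⇒' ψ) e p = λ q → Sat-ren⁺ D f ψ e (p (Sat-ren⁻ D f φ e q))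
  Sat-ren⁺ D f (∀' φ) e p = λ x dx → Sat-ren⁺ D (lift 1 f) φ (∷-lift x e) (p x dx)
  Sat-ren⁺ D f (∃' φ) e (x , dx , p) = x , dx , Sat-ren⁺ D (lift 1 f) φ (∷-lift x e) p
  Sat-ren⁺ D f (∀< t φ) e p = λ x dx l →
    Sat-ren⁺ D (lift 1 f) φ (∷-lift x e) (p x dx (subst (lt x) (⟦⟧-ren f t e) l))
  Sat-ren⁺ D f (∃< t φ) e (x , dx , l , p) =
    x , dx , subst (lt x) (sym (⟦⟧-ren f t e)) l , Sat-ren⁺ D (lift 1 f) φ (∷-lift x e) p
  Sat-ren⁻ D f (s ≐ t) e p = trans (sym (⟦⟧-ren f s e)) (trans p (⟦⟧-ren f t e))
  Sat-ren⁻ D f (s ≺ t) e p = subst₂ lt (⟦⟧-ren f s e) (⟦⟧-ren f t e) p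
  Sat-ren⁻ D f ⊥' e p = p
  Sat-ren⁻ D f (¬' φ) e p = λ q → p (Sat-ren⁺ D f φ e q)
  Sat-ren⁻ D f (φ ∧' ψ) e (p , q) = Sat-ren⁻ D f φ e p , Sat-ren⁻ D f ψ e q
  Sat-ren⁻ D f (φ ∨' ψ) e (inj₁ p) = inj₁ (Sat-ren⁻ D f φ e p)
  Sat-ren⁻ D f (φ ∨' ψ) e (inj₂ q) = inj₂ (Sat-ren⁻ D f ψ e q)
  Sat-ren⁻ D f (φ ⇒' ψ) e p = λ q → Sat-ren⁻ D f ψ e (p (Sat-ren⁺ D f φ e q))
  Sat-ren⁻ D f (∀' φ) e p = λ x dx → Sat-ren⁻ D (lift 1 f) φ (∷-lift x e) (p x dx)
  Sat-ren⁻ D f (∃' φ) e (x , dx , p) = x , dx , Sat-ren⁻ D (lift 1 f) φ (∷-lift x e) p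
  Sat-ren⁻ D f (∀< t φ) e p = λ x dx l →
    Sat-ren⁻ D (lift 1 f) φ (∷-lift x e) (p x dx (subst (lt x) (sym (⟦⟧-ren f t e)) l))
  Sat-ren⁻ D f (∃< t φ) e (x , dx , l , p) =
    x , dx , subst (lt x) (⟦⟧-ren f t e) l , Sat-ren⁻ D (lift 1 f) φ (∷-lift x e) p

  module Absoluteness {D : C → Set} (cut : IsCut M D) where
    open IsCut cut

    ⟦⟧∈ : ∀ {n} (t : Tm n) {ρ} → InD M D ρ → D (⟦ M ⟧ t ρ)
    ⟦⟧∈ (var i) dρ = dρ i
    ⟦⟧∈ 𝟎 dρ = proj₁ closed
    ⟦⟧∈ 𝟏 dρ = proj₁ (proj₂ closed)
    ⟦⟧∈ (s ⊕ t) dρ = proj₁ (proj₂ (proj₂ closed) _ _ (⟦⟧∈ s dρ) (⟦⟧∈ t dρ))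
    ⟦⟧∈ (s ⊗ t) dρ = proj₂ (proj₂ (proj₂ closed) _ _ (⟦⟧∈ s dρ) (⟦⟧∈ t dρ))

    Sat-abs⁺ : ∀ {n} {φ : Fm n} → IsΔ0 φ → ∀ {ρ} → InD M D ρ → Sat M D φ ρ → Sat M (All M) φ ρ
    Sat-abs⁻ : ∀ {n} {φ : Fm n} → IsΔ0 φ → ∀ {ρ} → InD M D ρ → Sat M (All M) φ ρ → Sat M D φ ρ
    Sat-abs⁺ (atEq s t) dρ p = p
    Sat-abs⁺ (atLt s t) dρ p = p
    Sat-abs⁺ bot dρ p = p
    Sat-abs⁺ (neg h) dρ p = λ q → p (Sat-abs⁻ h dρ q)
    Sat-abs⁺ (and h k) dρ (p , q) = Sat-abs⁺ h dρ p , Sat-abs⁺ k dρ q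
    Sat-abs⁺ (or h k) dρ (inj₁ p) = inj₁ (Sat-abs⁺ h dρ p)
    Sat-abs⁺ (or h k) dρ (inj₂ q) = inj₂ (Sat-abs⁺ k dρ q)
    Sat-abs⁺ (imp h k) dρ p = λ q → Sat-abs⁺ k dρ (p (Sat-abs⁻ h dρ q))
    Sat-abs⁺ (ball t h) dρ p = λ x _ l →
      let dx = down (inj₁ l) (⟦⟧∈ t dρ) in Sat-abs⁺ h (InD-∷ D dx dρ) (p x dx l)
    Sat-abs⁺ (bex t h) dρ (x , dx , l , p) = x , tt , l , Sat-abs⁺ h (InD-∷ D dx dρ) p
    Sat-abs⁻ (atEq s t) dρ p = p
    Sat-abs⁻ (atLt s t) dρ p = p
    Sat-abs⁻ bot dρ p = p
    Sat-abs⁻ (neg h) dρ p = λ q → p (Sat-abs⁺ h dρ q)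
    Sat-abs⁻ (and h k) dρ (p , q) = Sat-abs⁻ h dρ p , Sat-abs⁻ k dρ q
    Sat-abs⁻ (or h k) dρ (inj₁ p) = inj₁ (Sat-abs⁻ h dρ p)
    Sat-abs⁻ (or h k) dρ (inj₂ q) = inj₂ (Sat-abs⁻ k dρ q)
    Sat-abs⁻ (imp h k) dρ p = λ q → Sat-abs⁻ k dρ (p (Sat-abs⁺ h dρ q))
    Sat-abs⁻ (ball t h) dρ p = λ x dx l → Sat-abs⁻ h (InD-∷ D dx dρ) (p x tt l)
    Sat-abs⁻ (bex t h) dρ (x , _ , l , p) =
      let dx = down (inj₁ l) (⟦⟧∈ t dρ) in x , dx , l , Sat-abs⁻ h (InD-∷ D dx dρ) p

  module Embedding {j : C → C} (emb : SelfEmbedding M j) where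
    open SelfEmbedding emb

    ⟦⟧-embed : ∀ {n} (t : Tm n) {σ ρ} → σ ≗ j ∘ ρ → ⟦ M ⟧ t σ ≡ j (⟦ M ⟧ t ρ)
    ⟦⟧-embed (var i) e = e i
    ⟦⟧-embed 𝟎 e = sym pres-z
    ⟦⟧-embed 𝟏 e = sym pres-o
    ⟦⟧-embed (s ⊕ t) e = trans (cong₂ add (⟦⟧-embed s e) (⟦⟧-embed t e)) (sym (pres-add _ _))
    ⟦⟧-embed (s ⊗ t) e = trans (cong₂ mul (⟦⟧-embed s e) (⟦⟧-embed t e)) (sym (pres-mul _ _))

    ∷-embed : ∀ {n} {σ ρ : Vector C n} {y x} → y ≡ j x → σ ≗ j ∘ ρ → (y ∷ σ) ≗ j ∘ (x ∷ ρ)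
    ∷-embed e e′ zero = e
    ∷-embed e e′ (suc i) = e′ i

    Sat-embed⁺ : ∀ {n} (φ : Fm n) {σ ρ} → σ ≗ j ∘ ρ → Sat M (All M) φ ρ → Sat M (Image M j) φ σ
    Sat-embed⁻ : ∀ {n} (φ : Fm n) {σ ρ} → σ ≗ j ∘ ρ → Sat M (Image M j) φ σ → Sat M (All M) φ ρ
    Sat-embed⁺ (s ≐ t) e p = trans (⟦⟧-embed s e) (trans (cong j p) (sym (⟦⟧-embed t e)))
    Sat-embed⁺ (s ≺ t) e p = subst₂ lt (sym (⟦⟧-embed s e)) (sym (⟦⟧-embed t e)) (pres-lt _ _ p)
    Sat-embed⁺ ⊥' e p = p
    Sat-embed⁺ (¬' φ) e p = λ q → p (Sat-embed⁻ φ e q)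
    Sat-embed⁺ (φ ∧' ψ) e (p , q) = Sat-embed⁺ φ e p , Sat-embed⁺ ψ e q
    Sat-embed⁺ (φ ∨' ψ) e (inj₁ p) = inj₁ (Sat-embed⁺ φ e p)
    Sat-embed⁺ (φ ∨' ψ) e (inj₂ q) = inj₂ (Sat-embed⁺ ψ e q)
    Sat-embed⁺ (φ ⇒' ψ) e p = λ q → Sat-embed⁺ ψ e (p (Sat-embed⁻ φ e q))
    Sat-embed⁺ (∀' φ) e p = λ { y (x , refl) → Sat-embed⁺ φ (∷-embed refl e) (p x tt) }
    Sat-embed⁺ (∃' φ) e (x , _ , p) = j x , (x , refl) , Sat-embed⁺ φ (∷-embed refl e) p
    Sat-embed⁺ (∀< t φ) e p = λ { y (x , refl) l → Sat-embed⁺ φ (∷-embed refl e)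
      (p x tt (refl-lt _ _ (subst (lt (j x)) (⟦⟧-embed t e) l))) }
    Sat-embed⁺ (∃< t φ) e (x , _ , l , p) = j x , (x , refl) ,
      subst (lt (j x)) (sym (⟦⟧-embed t e)) (pres-lt _ _ l) , Sat-embed⁺ φ (∷-embed refl e) p
    Sat-embed⁻ (s ≐ t) e p = injective _ _ (trans (sym (⟦⟧-embed s e)) (trans p (⟦⟧-embed t e)))
    Sat-embed⁻ (s ≺ t) e p = refl-lt _ _ (subst₂ lt (⟦⟧-embed s e) (⟦⟧-embed t e) p)
    Sat-embed⁻ ⊥' e p = p
    Sat-embed⁻ (¬' φ) e p = λ q → p (Sat-embed⁺ φ e q)
    Sat-embed⁻ (φ ∧' ψ) e (p , q) = Sat-embed⁻ φ e p , Sat-embed⁻ ψ e q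
    Sat-embed⁻ (φ ∨' ψ) e (inj₁ p) = inj₁ (Sat-embed⁻ φ e p)
    Sat-embed⁻ (φ ∨' ψ) e (inj₂ q) = inj₂ (Sat-embed⁻ ψ e q)
    Sat-embed⁻ (φ ⇒' ψ) e p = λ q → Sat-embed⁻ ψ e (p (Sat-embed⁺ φ e q))
    Sat-embed⁻ (∀' φ) e p = λ x _ → Sat-embed⁻ φ (∷-embed refl e) (p (j x) (x , refl))
    Sat-embed⁻ (∃' φ) e (y , (x , refl) , p) = x , tt , Sat-embed⁻ φ (∷-embed refl e) p
    Sat-embed⁻ (∀< t φ) e p = λ x _ l → Sat-embed⁻ φ (∷-embed refl e)
      (p (j x) (x , refl) (subst (lt (j x)) (sym (⟦⟧-embed t e)) (pres-lt _ _ l)))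
    Sat-embed⁻ (∃< t φ) e (y , (x , refl) , l , p) =
      x , tt , refl-lt _ _ (subst (lt (j x)) (⟦⟧-embed t e) l) , Sat-embed⁻ φ (∷-embed refl e) p

module PA⁻ (M : Str) (pa : PAminus M (All M)) where
  open Str M

  infixl 6 _+_
  infixl 7 _*_
  infix 4 _<_ _≤_

  _+_ _*_ : C → C → C
  _+_ = add
  _*_ = mul

  _<_ _≤_ : C → C → Set
  _<_ = lt
  _≤_ = le M

  0# 1# : C
  0# = z
  1# = o

  record Laws : Set where
    field
      +-assoc      : ∀ x y w → (x + y) + w ≡ x + (y + w)
      +-comm       : ∀ x y → x + y ≡ y + x
      *-assoc      : ∀ x y w → (x * y) * w ≡ x * (y * w)
      *-comm       : ∀ x y → x * y ≡ y * x
      *-distribˡ-+ : ∀ x y w → x * (y + w) ≡ x * y + x * w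
      +-identityʳ  : ∀ x → x + 0# ≡ x
      *-zeroʳ      : ∀ x → x * 0# ≡ 0#
      *-identityʳ  : ∀ x → x * 1# ≡ x
      <-trans      : Transitive _<_
      <-irrefl     : ∀ {x} → ¬ x < x
      <-cmp        : ∀ x y → x < y ⊎ x ≡ y ⊎ y < x
      +-monoˡ-<    : ∀ w {x y} → x < y → x + w < y + w
      *-monoˡ-<    : ∀ {w x y} → 0# < w → x < y → x * w < y * w
      <⇒∃+         : ∀ {x y} → x < y → Σ C λ w → x + w ≡ y
      0<1          : 0# < 1#
      0<⇒1≤        : ∀ {x} → 0# < x → 1# ≤ x
      0≤           : ∀ x → 0# ≤ x

  laws : PAminus M (All M) → Laws
  laws (+a , +c , *a , *c , dist , +0*0 , *1 , <t , <i , cmp , +m , *m , sub , 0<1 , 1≤ , 0≤) = record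
    { +-assoc      = λ x y w → +a x y w tt tt tt
    ; +-comm       = λ x y → +c x y tt tt
    ; *-assoc      = λ x y w → *a x y w tt tt tt
    ; *-comm       = λ x y → *c x y tt tt
    ; *-distribˡ-+ = λ x y w → dist x y w tt tt tt
    ; +-identityʳ  = λ x → proj₁ (+0*0 x tt)
    ; *-zeroʳ      = λ x → proj₂ (+0*0 x tt)
    ; *-identityʳ  = λ x → *1 x tt
    ; <-trans      = <t _ _ _ tt tt tt
    ; <-irrefl     = <i _ tt
    ; <-cmp        = λ x y → cmp x y tt tt
    ; +-monoˡ-<    = λ w → +m _ _ w tt tt tt
    ; *-monoˡ-<    = *m _ _ _ tt tt tt
    ; <⇒∃+         = λ l → let (w , _ , e) = sub _ _ tt tt l in w , e
    ; 0<1          = 0<1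
    ; 0<⇒1≤        = 1≤ _ tt
    ; 0≤           = λ x → 0≤ x tt
    }

  open Laws (laws pa) public

  <-strictPartialOrder : StrictPartialOrder _ _ _
  <-strictPartialOrder = record
    { Carrier = C
    ; _≈_ = _≡_
    ; _<_ = _<_
    ; isStrictPartialOrder = record
      { isEquivalence = isEquivalence
      ; irrefl = λ { refl → <-irrefl }
      ; trans = <-trans
      ; <-resp-≈ = resp₂ _<_
      }
    }

  open StrictPartialOrderProperties <-strictPartialOrder public
    using () renaming (refl to ≤-refl; trans to ≤-trans; antisym to ≤-antisym)
  module ≤-Reasoning = StrictPartialOrderReasoning <-strictPartialOrder

  <-≤-trans : ∀ {x y w} → x < y → y ≤ w → x < w
  <-≤-trans = StrictToNonStrict.<-≤-trans _≡_ _<_ <-trans (respʳ _<_)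

  ≤-<-trans : ∀ {x y w} → x ≤ y → y < w → x < w
  ≤-<-trans = StrictToNonStrict.≤-<-trans _≡_ _<_ sym <-trans (respˡ _<_)

  <⇒≢ : ∀ {x y} → x < y → x ≢ y
  <⇒≢ l refl = <-irrefl l

  <⇒≱ : ∀ {x y} → x < y → ¬ y ≤ x
  <⇒≱ l l′ = <-irrefl (<-≤-trans l l′)

  ≤∧≢⇒< : ∀ {x y} → x ≤ y → x ≢ y → x < y
  ≤∧≢⇒< (inj₁ x<y) _ = x<y
  ≤∧≢⇒< (inj₂ x≡y) x≢y = ⊥-elim (x≢y x≡y)

  ≮⇒≥ : ∀ {x y} → ¬ x < y → y ≤ x
  ≮⇒≥ {x} {y} x≮y with <-cmp x y
  ... | inj₁ l = ⊥-elim (x≮y l)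
  ... | inj₂ (inj₁ e) = inj₂ (sym e)
  ... | inj₂ (inj₂ l) = inj₁ l

  ≡0⊎>0 : ∀ x → x ≡ 0# ⊎ 0# < x
  ≡0⊎>0 x with 0≤ x
  ... | inj₁ l = inj₂ l
  ... | inj₂ e = inj₁ (sym e)

  n≤0⇒n≡0 : ∀ {x} → x ≤ 0# → x ≡ 0#
  n≤0⇒n≡0 {x} l = ≤-antisym l (0≤ x)

  n<1⇒n≡0 : ∀ {x} → x < 1# → x ≡ 0#
  n<1⇒n≡0 {x} l with ≡0⊎>0 x
  ... | inj₁ e = e
  ... | inj₂ p = ⊥-elim (<⇒≱ l (0<⇒1≤ p))

  +-monoʳ-< : ∀ w {x y} → x < y → w + x < w + y
  +-monoʳ-< w {x} {y} l = subst₂ _<_ (+-comm x w) (+-comm y w) (+-monoˡ-< w l)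

  +-monoˡ-≤ : ∀ w {x y} → x ≤ y → x + w ≤ y + w
  +-monoˡ-≤ w (inj₁ l) = inj₁ (+-monoˡ-< w l)
  +-monoˡ-≤ w (inj₂ refl) = ≤-refl

  +-monoʳ-≤ : ∀ w {x y} → x ≤ y → w + x ≤ w + y
  +-monoʳ-≤ w (inj₁ l) = inj₁ (+-monoʳ-< w l)
  +-monoʳ-≤ w (inj₂ refl) = ≤-refl

  m≤m+n : ∀ x y → x ≤ x + y
  m≤m+n x y = subst (_≤ x + y) (+-identityʳ x) (+-monoʳ-≤ x (0≤ y))

  m≤n+m : ∀ x y → x ≤ y + x
  m≤n+m x y = subst (x ≤_) (+-comm x y) (m≤m+n x y)

  n<n+1 : ∀ x → x < x + 1#
  n<n+1 x = subst (_< x + 1#) (+-identityʳ x) (+-monoʳ-< x 0<1)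

  m<n⇒m+1≤n : ∀ {x y} → x < y → x + 1# ≤ y
  m<n⇒m+1≤n {x} l with <⇒∃+ l
  ... | w , e with ≡0⊎>0 w
  ... | inj₁ refl = ⊥-elim (<⇒≢ l (trans (sym (+-identityʳ x)) e))
  ... | inj₂ p = subst (x + 1# ≤_) e (+-monoʳ-≤ x (0<⇒1≤ p))

  m<n+1⇒m≤n : ∀ {x y} → x < y + 1# → x ≤ y
  m<n+1⇒m≤n l = ≮⇒≥ λ y<x → <⇒≱ l (m<n⇒m+1≤n y<x)

  m≤n⇒m<n+1 : ∀ {x y} → x ≤ y → x < y + 1#
  m≤n⇒m<n+1 {y = y} l = ≤-<-trans l (n<n+1 y)

  *-zeroˡ : ∀ x → 0# * x ≡ 0#
  *-zeroˡ x = trans (*-comm 0# x) (*-zeroʳ x)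

  *-identityˡ : ∀ x → 1# * x ≡ x
  *-identityˡ x = trans (*-comm 1# x) (*-identityʳ x)

  *-distribʳ-+ : ∀ w x y → (x + y) * w ≡ x * w + y * w
  *-distribʳ-+ w x y = begin
    (x + y) * w     ≡⟨ *-comm (x + y) w ⟩
    w * (x + y)     ≡⟨ *-distribˡ-+ w x y ⟩
    w * x + w * y   ≡⟨ cong₂ _+_ (*-comm w x) (*-comm w y) ⟩
    x * w + y * w   ∎
    where open ≡-Reasoning

  *-monoˡ-≤ : ∀ w {x y} → x ≤ y → x * w ≤ y * w
  *-monoˡ-≤ w (inj₂ refl) = ≤-refl
  *-monoˡ-≤ w {x} {y} (inj₁ l) with ≡0⊎>0 w
  ... | inj₁ refl = inj₂ (trans (*-zeroʳ x) (sym (*-zeroʳ y)))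
  ... | inj₂ p = inj₁ (*-monoˡ-< p l)

  m≤n*m : ∀ x {w} → 1# ≤ w → x ≤ w * x
  m≤n*m x l = subst (_≤ _ * x) (*-identityˡ x) (*-monoˡ-≤ x l)

  [m+1]*n≡m*n+n : ∀ x w → (x + 1#) * w ≡ x * w + w
  [m+1]*n≡m*n+n x w = trans (*-distribʳ-+ w x 1#) (cong (x * w +_) (*-identityˡ w))

  m<n⇒m*w+r<n*w+s : ∀ {m n w r s} → r < w → m < n → m * w + r < n * w + s
  m<n⇒m*w+r<n*w+s {m} {n} {w} {r} {s} r<w m<n = begin-strict
    m * w + r         <⟨ +-monoʳ-< (m * w) r<w ⟩
    m * w + w         ≡⟨ [m+1]*n≡m*n+n m w ⟨
    (m + 1#) * w      ≤⟨ *-monoˡ-≤ w (m<n⇒m+1≤n m<n) ⟩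
    n * w             ≤⟨ m≤m+n (n * w) s ⟩
    n * w + s         ∎
    where open ≤-Reasoning

  quotient-unique : ∀ {q r q′ r′ w} → r < w → r′ < w → q * w + r ≡ q′ * w + r′ → q ≡ q′
  quotient-unique {q} {r} {q′} {r′} l l′ e with <-cmp q q′
  ... | inj₁ q<q′ = ⊥-elim (<⇒≢ (m<n⇒m*w+r<n*w+s l q<q′) e)
  ... | inj₂ (inj₁ q≡q′) = q≡q′
  ... | inj₂ (inj₂ q′<q) = ⊥-elim (<⇒≢ (m<n⇒m*w+r<n*w+s l′ q′<q) (sym e))

  2# : C
  2# = 1# + 1#

  0<2 : 0# < 2#
  0<2 = <-≤-trans 0<1 (m≤m+n 1# 1#)

  +-mono-< : ∀ {x y u v} → x < y → u < v → x + u < y + v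
  +-mono-< {y = y} {u} x<y u<v = <-trans (+-monoˡ-< u x<y) (+-monoʳ-< y u<v)

  *2+-regroup : ∀ s b w r → (s * 2# + b) * w + r ≡ s * (w + w) + (b * w + r)
  *2+-regroup s b w r = begin
    (s * 2# + b) * w + r        ≡⟨ cong (_+ r) (*-distribʳ-+ w (s * 2#) b) ⟩
    s * 2# * w + b * w + r      ≡⟨ +-assoc (s * 2# * w) (b * w) r ⟩
    s * 2# * w + (b * w + r)    ≡⟨ cong (_+ (b * w + r)) (*-assoc s 2# w) ⟩
    s * (2# * w) + (b * w + r)  ≡⟨ cong (λ a → s * a + (b * w + r)) 2*w≡w+w ⟩
    s * (w + w) + (b * w + r)   ∎
    where
    open ≡-Reasoning
    2*w≡w+w : 2# * w ≡ w + w
    2*w≡w+w = trans (*-distribʳ-+ w 1# 1#) (cong₂ _+_ (*-identityˡ w) (*-identityˡ w))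

  bit*w+r<w+w : ∀ {b w r} → b < 2# → r < w → b * w + r < w + w
  bit*w+r<w+w {b} {w} {r} b<2 r<w = begin-strict
    b * w + r     <⟨ +-monoʳ-< (b * w) r<w ⟩
    b * w + w     ≤⟨ +-monoˡ-≤ w (*-monoˡ-≤ w (m<n+1⇒m≤n b<2)) ⟩
    1# * w + w    ≡⟨ cong (_+ w) (*-identityˡ w) ⟩
    w + w         ∎
    where open ≤-Reasoning

  divisor≤ : ∀ {x s w r} → 0# < s → x ≡ s * w + r → w ≤ x
  divisor≤ {x} {s} {w} {r} 0<s x≡ = begin
    w          ≤⟨ m≤n*m w (0<⇒1≤ 0<s) ⟩
    s * w      ≤⟨ m≤m+n (s * w) r ⟩
    s * w + r  ≡⟨ x≡ ⟨
    x          ∎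
    where open ≤-Reasoning

  quotient≤ : ∀ {x q w r} → r < w → x ≡ q * w + r → q ≤ x
  quotient≤ {q = q} {w} {r} r<w x≡ =
    divisor≤ (≤-<-trans (0≤ r) r<w) (trans x≡ (cong (_+ r) (*-comm q w)))

  distinct-congruent⇒≤+ : ∀ {x x′ s s′ w r} → x ≡ s * w + r → x′ ≡ s′ * w + r → x ≢ x′ →
    w ≤ x + x′
  distinct-congruent⇒≤+ {x} {x′} {s} {s′} x≡ x′≡ x≢x′ with ≡0⊎>0 s | ≡0⊎>0 s′
  ... | inj₂ 0<s | _ = ≤-trans (divisor≤ 0<s x≡) (m≤m+n x x′)
  ... | inj₁ _ | inj₂ 0<s′ = ≤-trans (divisor≤ 0<s′ x′≡) (m≤n+m x′ x)
  ... | inj₁ refl | inj₁ refl = ⊥-elim (x≢x′ (trans x≡ (sym x′≡)))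

module IΔ0-Consequences (M : Str) (iM : IΔ0 M (All M)) where
  open Str M
  open Semantics M
  open PA⁻ M (proj₁ iM)

  record Δ0Definable (P : C → Set) : Set where
    field
      {arity}  : ℕ
      formula  : Fm (suc arity)
      isΔ0     : IsΔ0 formula
      params   : Vector C arity
      sound    : ∀ {x} → Sat M (All M) formula (x ∷ params) → P x
      complete : ∀ {x} → P x → Sat M (All M) formula (x ∷ params)

  Sat-definable : ∀ {n} {φ : Fm (suc n)} → IsΔ0 φ → (ρ : Vector C n) →
    Δ0Definable (λ x → Sat M (All M) φ (x ∷ ρ))
  Sat-definable h ρ = record { isΔ0 = h ; params = ρ ; sound = λ p → p ; complete = λ p → p }

  Δ0-induction : ∀ {P} → Δ0Definable P → P 0# → (∀ x → P x → P (x + 1#)) → ∀ x → P x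
  Δ0-induction def p0 step x =
    sound (proj₂ iM formula isΔ0 params (λ _ → tt) (complete p0) (λ y _ p → complete (step y (sound p))) x tt)
    where open Δ0Definable def

  ≤⇒-definable : ∀ {P} → Δ0Definable P → ∀ m → Δ0Definable (λ x → x ≤ m → P x)
  ≤⇒-definable def m = record
    { formula  = (var (# 0) ≺ var (# 1) ⊕ 𝟏) ⇒' ren (lift 1 suc) formula
    ; isΔ0     = imp (atLt _ _) (ren-Δ0 _ isΔ0)
    ; params   = m ∷ params
    ; sound    = λ p x≤m → sound (Sat-ren⁻ _ (lift 1 suc) formula skip-m (p (m≤n⇒m<n+1 x≤m)))
    ; complete = λ p x<m+1 → Sat-ren⁺ _ (lift 1 suc) formula skip-m (complete (p (m<n+1⇒m≤n x<m+1)))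
    }
    where
    open Δ0Definable def
    skip-m : ∀ {x} → (x ∷ m ∷ params) ∘ lift 1 suc ≗ (x ∷ params)
    skip-m {x} = ∷-lift x (λ _ → refl)

  Δ0-induction-≤ : ∀ {P} → Δ0Definable P → ∀ m → P 0# → (∀ x → x < m → P x → P (x + 1#)) →
    ∀ x → x ≤ m → P x
  Δ0-induction-≤ def m p0 step = Δ0-induction (≤⇒-definable def m) (λ _ → p0)
    λ x ih x+1≤m → step x (<-≤-trans (n<n+1 x) x+1≤m) (ih (≤-trans (inj₁ (n<n+1 x)) x+1≤m))

  division : ∀ {w} → 0# < w → ∀ x → Σ C λ q → Σ C λ r → r < w × x ≡ q * w + r
  division {w} 0<w = Δ0-induction def (0# , 0# , 0<w , base) step
    where
    def : Δ0Definable (λ x → Σ C λ q → Σ C λ r → r < w × x ≡ q * w + r)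
    def = record
      -- ∃ q < x + 1. ∃ r < w. x = q·w + r
      { formula  = ∃< (var (# 0) ⊕ 𝟏) (∃< (var (# 2)) (var (# 2) ≐ var (# 1) ⊗ var (# 3) ⊕ var (# 0)))
      ; isΔ0     = bex _ (bex _ (atEq _ _))
      ; params   = w ∷ []
      ; sound    = λ { (q , _ , _ , r , _ , r<w , x≡) → q , r , r<w , x≡ }
      ; complete = λ { (q , r , r<w , x≡) → q , tt , m≤n⇒m<n+1 (quotient≤ r<w x≡) , r , tt , r<w , x≡ }
      }
    base : 0# ≡ 0# * w + 0#
    base = sym (trans (+-identityʳ _) (*-zeroˡ w))
    step : ∀ x → (Σ C λ q → Σ C λ r → r < w × x ≡ q * w + r) →
      Σ C λ q → Σ C λ r → r < w × x + 1# ≡ q * w + r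
    step x (q , r , r<w , x≡) with m<n⇒m+1≤n r<w
    ... | inj₁ r+1<w = q , r + 1# , r+1<w , trans (cong (_+ 1#) x≡) (+-assoc _ r 1#)
    ... | inj₂ r+1≡w = q + 1# , 0# , 0<w , (begin
      x + 1#               ≡⟨ cong (_+ 1#) x≡ ⟩
      q * w + r + 1#       ≡⟨ +-assoc _ r 1# ⟩
      q * w + (r + 1#)     ≡⟨ cong (q * w +_) r+1≡w ⟩
      q * w + w            ≡⟨ [m+1]*n≡m*n+n q w ⟨
      (q + 1#) * w         ≡⟨ +-identityʳ _ ⟨
      (q + 1#) * w + 0#    ∎)
      where open ≡-Reasoning

module ExpFormula (M : Str) (iM : IΔ0 M (All M)) (E : Fm 2) (isE : IsExpFormula E) where
  open Str M
  open Semantics M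
  open PA⁻ M (proj₁ iM)
  open IΔ0-Consequences M iM

  Exp : C → C → Set
  Exp x y = Sat M (All M) E (x ∷ y ∷ [])

  Exp-zero⁻ : ∀ {y} → Exp 0# y → y ≡ 1#
  Exp-zero⁻ = proj₁ (proj₁ (proj₂ isE M iM) _)

  Exp-zero⁺ : Exp 0# 1#
  Exp-zero⁺ = proj₂ (proj₁ (proj₂ isE M iM) _) refl

  Exp-suc⁻ : ∀ {x y} → Exp (x + 1#) y → Σ C λ w → w ≤ y × Exp x w × y ≡ w + w
  Exp-suc⁻ = proj₁ (proj₂ (proj₂ isE M iM) _ _)

  Exp-suc⁺ : ∀ {x w} → Exp x w → Exp (x + 1#) (w + w)
  Exp-suc⁺ {w = w} p = proj₂ (proj₂ (proj₂ isE M iM) _ _) (w , m≤m+n w w , p , refl)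

  Exp-at : ∀ {n} → Fin n → Fin n → Fm n
  Exp-at a b = ren (a ∷ b ∷ []) E

  Exp-at-Δ0 : ∀ {n} (a b : Fin n) → IsΔ0 (Exp-at a b)
  Exp-at-Δ0 a b = ren-Δ0 _ (proj₁ isE)

  private
    at : ∀ {n} (a b : Fin n) (σ : Vector C n) → σ ∘ (a ∷ b ∷ []) ≗ (σ a ∷ σ b ∷ [])
    at a b σ zero = refl
    at a b σ (suc zero) = refl

  Sat-Exp-at⁺ : ∀ {n} (a b : Fin n) {σ} → Exp (σ a) (σ b) → Sat M (All M) (Exp-at a b) σ
  Sat-Exp-at⁺ a b {σ} = Sat-ren⁺ _ _ E (at a b σ)

  Sat-Exp-at⁻ : ∀ {n} (a b : Fin n) {σ} → Sat M (All M) (Exp-at a b) σ → Exp (σ a) (σ b)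
  Sat-Exp-at⁻ a b {σ} = Sat-ren⁻ _ _ E (at a b σ)

  Exp-functional : ∀ {x y y′} → Exp x y → Exp x y′ → y ≡ y′
  Exp-functional {x} {y} {y′} =
    Δ0-induction def base step x y (m≤n⇒m<n+1 (m≤m+n y y′)) y′ (m≤n⇒m<n+1 (m≤n+m y′ y))
    where
    bound : C
    bound = y + y′ + 1#
    Functional : C → Set
    Functional k = ∀ w → w < bound → ∀ w′ → w′ < bound → Exp k w → Exp k w′ → w ≡ w′
    def : Δ0Definable Functional
    def = record
      { formula  = ∀< (var (# 1)) (∀< (var (# 2))
                     (Exp-at (# 2) (# 1) ⇒' Exp-at (# 2) (# 0) ⇒' var (# 1) ≐ var (# 0)))
      ; isΔ0     = ball _ (ball _ (imp (Exp-at-Δ0 _ _) (imp (Exp-at-Δ0 _ _) (atEq _ _))))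
      ; params   = bound ∷ []
      ; sound    = λ h w w< w′ w′< e e′ →
                     h w tt w< w′ tt w′< (Sat-Exp-at⁺ (# 2) (# 1) e) (Sat-Exp-at⁺ (# 2) (# 0) e′)
      ; complete = λ h w _ w< w′ _ w′< e e′ →
                     h w w< w′ w′< (Sat-Exp-at⁻ (# 2) (# 1) e) (Sat-Exp-at⁻ (# 2) (# 0) e′)
      }
    base : Functional 0#
    base w _ w′ _ e e′ = trans (Exp-zero⁻ e) (sym (Exp-zero⁻ e′))
    step : ∀ k → Functional k → Functional (k + 1#)
    step k ih w w< w′ w′< e e′ with Exp-suc⁻ e | Exp-suc⁻ e′
    ... | u , u≤w , eu , w≡u+u | u′ , u′≤w′ , eu′ , w′≡u′+u′ =
      trans w≡u+u (trans (cong (λ a → a + a) u≡u′) (sym w′≡u′+u′))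
      where
      u≡u′ : u ≡ u′
      u≡u′ = ih u (≤-<-trans u≤w w<) u′ (≤-<-trans u′≤w′ w′<) eu eu′

module Cut (M : Str) (iM : IΔ0 M (All M)) {D : Str.C M → Set} (cut : IsCut M D) where
  open Str M
  open Semantics M
  open PA⁻ M (proj₁ iM)
  open IΔ0-Consequences M iM
  open IsCut cut
  open Absoluteness cut

  0∈ : D 0#
  0∈ = proj₁ closed

  +1∈ : ∀ {x} → D x → D (x + 1#)
  +1∈ x∈D = proj₁ (proj₂ (proj₂ closed) _ _ x∈D (proj₁ (proj₂ closed)))

  below : ∀ {x c} → D x → ¬ D c → x < c
  below {x} {c} x∈D c∉D with <-cmp x c
  ... | inj₁ x<c = x<c
  ... | inj₂ (inj₁ refl) = ⊥-elim (c∉D x∈D)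
  ... | inj₂ (inj₂ c<x) = ⊥-elim (c∉D (down (inj₁ c<x) x∈D))

  PAminus-cut : PAminus M D
  PAminus-cut =
      (λ x y w _ _ _ → +-assoc x y w) , (λ x y _ _ → +-comm x y)
    , (λ x y w _ _ _ → *-assoc x y w) , (λ x y _ _ → *-comm x y)
    , (λ x y w _ _ _ → *-distribˡ-+ x y w) , (λ x _ → +-identityʳ x , *-zeroʳ x)
    , (λ x _ → *-identityʳ x) , (λ x y w _ _ _ → <-trans) , (λ x _ → <-irrefl)
    , (λ x y _ _ → <-cmp x y) , (λ x y w _ _ _ → +-monoˡ-< w) , (λ x y w _ _ _ → *-monoˡ-<)
    , (λ x y _ y∈D x<y → let (w , x+w≡y) = <⇒∃+ x<y in
         w , down (subst (w ≤_) x+w≡y (m≤n+m w x)) y∈D , x+w≡y)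
    , 0<1 , (λ x _ → 0<⇒1≤) , (λ x _ → 0≤ x)

  IndΔ0-cut : IndΔ0 M D
  IndΔ0-cut φ h ρ ρ∈D base step x x∈D =
    Sat-abs⁻ h (InD-∷ D x∈D ρ∈D) (Δ0-induction-≤ (Sat-definable h ρ) x base′ step′ x ≤-refl)
    where
    base′ : Sat M (All M) φ (0# ∷ ρ)
    base′ = Sat-abs⁺ h (InD-∷ D 0∈ ρ∈D) base
    step′ : ∀ u → u < x → Sat M (All M) φ (u ∷ ρ) → Sat M (All M) φ (u + 1# ∷ ρ)
    step′ u u<x p = Sat-abs⁺ h (InD-∷ D u+1∈D ρ∈D) (step u u∈D (Sat-abs⁻ h (InD-∷ D u∈D ρ∈D) p))
      where
      u∈D : D u
      u∈D = down (inj₁ u<x) x∈D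
      u+1∈D : D (u + 1#)
      u+1∈D = down (m<n⇒m+1≤n u<x) x∈D

  Sat-boundedRen⁺ : ∀ {n m} (f : Fin n → Fin m) {φ : Fm n} (s : IsΣ1 φ) (t : Tm m) {σ τ} →
    σ ∘ f ≗ τ → InD M D τ → ¬ D (⟦ M ⟧ t σ) → Sat M D φ τ → Sat M (All M) (boundedRen f s t) σ
  Sat-boundedRen⁺ f {φ} (δ0 h) t e τ∈D t∉D p = Sat-ren⁺ _ f φ e (Sat-abs⁺ h τ∈D p)
  Sat-boundedRen⁺ f (ex s) t e τ∈D t∉D (x , x∈D , p) =
    x , tt , below x∈D t∉D ,
    Sat-boundedRen⁺ (lift 1 f) s (renᵗ suc t) (∷-lift x e) (InD-∷ D x∈D τ∈D)
      (subst (¬_ ∘ D) (sym (⟦⟧-weaken t)) t∉D) p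

  Sat-boundedRen⁻ : ∀ {n m} (f : Fin n → Fin m) {φ : Fm n} (s : IsΣ1 φ) (t : Tm m) {σ τ} →
    σ ∘ f ≗ τ → InD M D τ → D (⟦ M ⟧ t σ) → Sat M (All M) (boundedRen f s t) σ → Sat M D φ τ
  Sat-boundedRen⁻ f {φ} (δ0 h) t e τ∈D t∈D p = Sat-abs⁻ h τ∈D (Sat-ren⁻ _ f φ e p)
  Sat-boundedRen⁻ f (ex s) t e τ∈D t∈D (x , _ , x<t , p) =
    x , x∈D ,
    Sat-boundedRen⁻ (lift 1 f) s (renᵗ suc t) (∷-lift x e) (InD-∷ D x∈D τ∈D)
      (subst D (sym (⟦⟧-weaken t)) t∈D) p
    where
    x∈D : D x
    x∈D = down (inj₁ x<t) t∈D

  private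
    skip₂ : ∀ {n} → Fin (suc (suc n)) → Fin (suc (suc (suc (suc n))))
    skip₂ = lift 2 λ i → suc (suc i)

    skip₂-≗ : ∀ {n} {y x c v : C} {ρ : Vector C n} → (y ∷ x ∷ c ∷ v ∷ ρ) ∘ skip₂ ≗ (y ∷ x ∷ ρ)
    skip₂-≗ zero = refl
    skip₂-≗ (suc zero) = refl
    skip₂-≗ (suc (suc i)) = refl

  -- ∀ x < v. ∃ y < c. φ(y, x, ρ) with the witnesses of φ bounded by c, in context (c, v, ρ)
  collected : ∀ {n} {φ : Fm (suc (suc n))} → IsΣ1 φ → Fm (suc (suc n))
  collected s = ∀< (var (# 1)) (∃< (var (# 1)) (boundedRen skip₂ s (var (# 2))))

  collected-Δ0 : ∀ {n} {φ : Fm (suc (suc n))} (s : IsΣ1 φ) → IsΔ0 (collected s)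
  collected-Δ0 s = ball _ (bex _ (boundedRen-Δ0 skip₂ s (var (# 2))))

  Collects : ∀ {n} {φ : Fm (suc (suc n))} → IsΣ1 φ → Vector C n → C → C → Set
  Collects s ρ v c = Sat M (All M) (collected s) (c ∷ v ∷ ρ)

  Collects⇒bounded : ∀ {n} {φ : Fm (suc (suc n))} (s : IsΣ1 φ) {ρ v c} → InD M D ρ → D c →
    Collects s ρ v c → ∀ x → D x → x < v → Σ C λ y → D y × y < c × Sat M D φ (y ∷ x ∷ ρ)
  Collects⇒bounded s ρ∈D c∈D p x x∈D x<v with p x tt x<v
  ... | y , _ , y<c , q = y , y∈D , y<c ,
    Sat-boundedRen⁻ skip₂ s _ skip₂-≗ (InD-∷ D y∈D (InD-∷ D x∈D ρ∈D)) c∈D q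
    where
    y∈D : D y
    y∈D = down (inj₁ y<c) c∈D

  total⇒Collects : ∀ {n} {φ : Fm (suc (suc n))} (s : IsΣ1 φ) {ρ v c} → InD M D ρ → D v → ¬ D c →
    (∀ x → D x → x < v → Σ C λ y → D y × Sat M D φ (y ∷ x ∷ ρ)) → Collects s ρ v c
  total⇒Collects {φ = φ} s {ρ} {v} {c} ρ∈D v∈D c∉D total x _ x<v = witness (total x x∈D x<v)
    where
    x∈D : D x
    x∈D = down (inj₁ x<v) v∈D
    witness : (Σ C λ y → D y × Sat M D φ (y ∷ x ∷ ρ)) →
      Σ C λ y → ⊤ × y < c × Sat M (All M) (boundedRen skip₂ s (var (# 2))) (y ∷ x ∷ c ∷ v ∷ ρ)
    witness (y , y∈D , q) = y , tt , below y∈D c∉D ,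
      Sat-boundedRen⁺ skip₂ s _ skip₂-≗ (InD-∷ D y∈D (InD-∷ D x∈D ρ∈D)) c∉D q

  Collects-definable : ∀ {n} {φ : Fm (suc (suc n))} (s : IsΣ1 φ) ρ v →
    Δ0Definable (λ c → ¬ Collects s ρ v c)
  Collects-definable s ρ v = Sat-definable (neg (collected-Δ0 s)) (v ∷ ρ)

  module Proper (lem : LEM) {c₀ : C} (c₀∉D : ¬ D c₀) where

    overspill : ∀ {P} → Δ0Definable P → (∀ x → D x → P x) → Σ C λ c → ¬ D c × P c
    overspill {P} def P-on-D with lem (Σ C λ c → ¬ D c × P c)
    ... | inj₁ found = found
    ... | inj₂ none = ⊥-elim (none (c₀ , c₀∉D , Δ0-induction def (P-on-D 0# 0∈) step c₀))
      where
      step : ∀ x → P x → P (x + 1#)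
      step x p with lem (D x)
      ... | inj₁ x∈D = P-on-D _ (+1∈ x∈D)
      ... | inj₂ x∉D = ⊥-elim (none (x , x∉D , p))

    BΣ1-cut : BΣ1 M D
    BΣ1-cut φ s ρ ρ∈D v v∈D total with lem (Σ C λ c → D c × Collects s ρ v c)
    ... | inj₁ (c , c∈D , p) = c , c∈D , Collects⇒bounded s ρ∈D c∈D p
    ... | inj₂ none with overspill (Collects-definable s ρ v) (λ c c∈D p → none (c , c∈D , p))
    ... | c , c∉D , ¬p = ⊥-elim (¬p (total⇒Collects s ρ∈D v∈D c∉D total))

module FixedInitialSegment (M : Str) (iM : IΔ0 M (All M)) {j : Str.C M → Str.C M}
  (emb : SelfEmbedding M j) where
  open Str M
  open Semantics M
  open PA⁻ M (proj₁ iM)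
  open IΔ0-Consequences M iM
  open SelfEmbedding emb

  I : C → Set
  I = Ifix M j

  Ifix-down : ∀ {x y} → x ≤ y → I y → I x
  Ifix-down x≤y y∈I u u≤x = y∈I u (≤-trans u≤x x≤y)

  fixed : ∀ {x} → I x → j x ≡ x
  fixed x∈I = x∈I _ ≤-refl

  j-divmod : ∀ {x q w r} → j w ≡ w → x ≡ q * w + r → j x ≡ j q * w + j r
  j-divmod {x} {q} {w} {r} jw≡w x≡ = begin
    j x                 ≡⟨ cong j x≡ ⟩
    j (q * w + r)       ≡⟨ pres-add (q * w) r ⟩
    j (q * w) + j r     ≡⟨ cong (_+ j r) (pres-mul q w) ⟩
    j q * j w + j r     ≡⟨ cong (λ a → j q * a + j r) jw≡w ⟩
    j q * w + j r       ∎
    where open ≡-Reasoning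

  j-<-fixed : ∀ {r w} → j w ≡ w → r < w → j r < w
  j-<-fixed jw≡w r<w = subst (_ <_) jw≡w (pres-lt _ _ r<w)

  0∈Ifix : I 0#
  0∈Ifix u u≤0 rewrite n≤0⇒n≡0 u≤0 = pres-z

  1∈Ifix : I 1#
  1∈Ifix u (inj₁ u<1) rewrite n<1⇒n≡0 u<1 = pres-z
  1∈Ifix u (inj₂ refl) = pres-o

  +∈Ifix : ∀ {a b} → I a → I b → I (a + b)
  +∈Ifix {a} {b} a∈I b∈I u u≤a+b with <-cmp a u
  ... | inj₂ (inj₁ refl) = fixed a∈I
  ... | inj₂ (inj₂ u<a) = a∈I u (inj₁ u<a)
  ... | inj₁ a<u with <⇒∃+ a<u
  ... | w , refl = trans (pres-add a w) (cong₂ _+_ (fixed a∈I) (b∈I w w≤b))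
    where
    w≤b : w ≤ b
    w≤b = ≮⇒≥ λ b<w → <⇒≱ (+-monoʳ-< a b<w) u≤a+b

  *∈Ifix : ∀ {a b} → I a → I b → I (a * b)
  *∈Ifix {a} {b} a∈I b∈I u u≤ab with ≡0⊎>0 a
  ... | inj₁ refl = 0∈Ifix u (subst (u ≤_) (*-zeroˡ b) u≤ab)
  ... | inj₂ 0<a with division 0<a u
  ... | q , r , r<a , u≡ =
    trans (j-divmod (fixed a∈I) u≡) (trans (cong₂ _+_ (cong (_* a) (b∈I q q≤b)) (a∈I r (inj₁ r<a))) (sym u≡))
    where
    q≤b : q ≤ b
    q≤b = ≮⇒≥ λ b<q → <-irrefl (begin-strict
      b * a + 0#   <⟨ m<n⇒m*w+r<n*w+s 0<a b<q ⟩
      q * a + r    ≡⟨ u≡ ⟨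
      u            ≤⟨ u≤ab ⟩
      a * b        ≡⟨ *-comm a b ⟩
      b * a        ≡⟨ +-identityʳ (b * a) ⟨
      b * a + 0#   ∎)
      where open ≤-Reasoning

  2∈Ifix : I 2#
  2∈Ifix = +∈Ifix 1∈Ifix 1∈Ifix

  Ifix-cut : IsCut M I
  Ifix-cut = record
    { closed = 0∈Ifix , 1∈Ifix , λ _ _ a∈I b∈I → +∈Ifix a∈I b∈I , *∈Ifix a∈I b∈I
    ; down   = Ifix-down
    }

  Ifix-proper : Nontrivial M j → Σ C λ c → ¬ I c
  Ifix-proper (c , jc≢c) = c , λ c∈I → jc≢c (fixed c∈I)

  module _ (elem : Δ0Elementary M j) (E : Fm 2) (isE : IsExpFormula E) where
    open ExpFormula M iM E isE

    Exp-fixed : ∀ {k w} → j k ≡ k → Exp k w → j w ≡ w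
    Exp-fixed {k} {w} jk≡k p = sym (Exp-functional p p′)
      where
      images : (k ∷ j w ∷ []) ≗ j ∘ (k ∷ w ∷ [])
      images zero = sym jk≡k
      images (suc zero) = refl
      in-image : InD M (Image M j) (k ∷ j w ∷ [])
      in-image zero = k , jk≡k
      in-image (suc zero) = w , refl
      p′ : Exp k (j w)
      p′ = proj₁ (elem E (proj₁ isE) _ in-image) (Embedding.Sat-embed⁺ emb E images p)

    CongruentMod2^ : C → C → C → Set
    CongruentMod2^ k x x′ = Σ C λ w → Exp k w ×
      Σ C λ q → Σ C λ q′ → Σ C λ r → r < w × x ≡ q * w + r × x′ ≡ q′ * w + r

    CongruentMod2^⇒≤+ : ∀ {k w x x′} → x ≢ x′ → Exp k w → CongruentMod2^ k x x′ → w ≤ x + x′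
    CongruentMod2^⇒≤+ {x = x} {x′} x≢x′ ew (w′ , ew′ , _ , _ , _ , _ , x≡ , x′≡) =
      subst (_≤ x + x′) (Exp-functional ew′ ew) (distinct-congruent⇒≤+ x≡ x′≡ x≢x′)

    CongruentMod2^-definable : ∀ {x x′} → x ≢ x′ → Δ0Definable (λ k → CongruentMod2^ k x x′)
    CongruentMod2^-definable {x} {x′} x≢x′ = record
      -- ∃ w < x + x′ + 1. E(k, w) ∧ ∃ q < x + 1. ∃ q′ < x′ + 1. ∃ r < w. x = q·w + r ∧ x′ = q′·w + r
      -- (the bound on w holds only because x ≢ x′)
      { formula  = ∃< (var (# 1) ⊕ var (# 2) ⊕ 𝟏) (Exp-at (# 1) (# 0) ∧'
                     ∃< (var (# 2) ⊕ 𝟏) (∃< (var (# 4) ⊕ 𝟏) (∃< (var (# 2))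
                       (var (# 5) ≐ var (# 2) ⊗ var (# 3) ⊕ var (# 0) ∧'
                        var (# 6) ≐ var (# 1) ⊗ var (# 3) ⊕ var (# 0)))))
      ; isΔ0     = bex _ (and (Exp-at-Δ0 _ _) (bex _ (bex _ (bex _ (and (atEq _ _) (atEq _ _))))))
      ; params   = x ∷ x′ ∷ []
      ; sound    = λ { (w , _ , _ , ew , q , _ , _ , q′ , _ , _ , r , _ , r<w , x≡ , x′≡) →
                       w , Sat-Exp-at⁻ (# 1) (# 0) ew , q , q′ , r , r<w , x≡ , x′≡ }
      ; complete = λ { (w , ew , q , q′ , r , r<w , x≡ , x′≡) →
                       w , tt , m≤n⇒m<n+1 (distinct-congruent⇒≤+ x≡ x′≡ x≢x′) ,
                       Sat-Exp-at⁺ (# 1) (# 0) ew ,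
                       q , tt , m≤n⇒m<n+1 (quotient≤ r<w x≡) ,
                       q′ , tt , m≤n⇒m<n+1 (quotient≤ r<w x′≡) ,
                       r , tt , r<w , x≡ , x′≡ }
      }

    CongruentMod2^-zero : ∀ x x′ → CongruentMod2^ 0# x x′
    CongruentMod2^-zero x x′ = 1# , Exp-zero⁺ , x , x′ , 0# , 0<1 , unit x , unit x′
      where
      unit : ∀ y → y ≡ y * 1# + 0#
      unit y = sym (trans (+-identityʳ _) (*-identityʳ y))

    -- j fixes w = 2^k, so the quotients of x and j x by w are q and j q; splitting q = 2s + b,
    -- where j fixes the bit b, gives their representations modulo 2w.
    CongruentMod2^-suc : ∀ {k x} → j k ≡ k →
      CongruentMod2^ k x (j x) → CongruentMod2^ (k + 1#) x (j x)
    CongruentMod2^-suc {k} {x} jk≡k (w , ew , q , q′ , r , r<w , x≡ , jx≡) with division 0<2 q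
    ... | s , b , b<2 , q≡ =
      w + w , Exp-suc⁺ ew , s , j s , b * w + r , bit*w+r<w+w b<2 r<w ,
      trans x≡ (regroup q≡) , trans jx≡ (regroup q′≡)
      where
      jw≡w : j w ≡ w
      jw≡w = Exp-fixed jk≡k ew
      q′≡jq : q′ ≡ j q
      q′≡jq = quotient-unique r<w (j-<-fixed jw≡w r<w) (trans (sym jx≡) (j-divmod jw≡w x≡))
      q′≡ : q′ ≡ j s * 2# + b
      q′≡ = trans q′≡jq (trans (j-divmod (fixed 2∈Ifix) q≡) (cong (j s * 2# +_) (2∈Ifix b (inj₁ b<2))))
      regroup : ∀ {s′ q″} → q″ ≡ s′ * 2# + b → q″ * w + r ≡ s′ * (w + w) + (b * w + r)
      regroup {s′} q″≡ = trans (cong (λ a → a * w + r) q″≡) (*2+-regroup s′ b w r)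

    CongruentMod2^-≤ : ∀ {m x} → I m → x ≢ j x → ∀ k → k ≤ m → CongruentMod2^ k x (j x)
    CongruentMod2^-≤ {m} {x} m∈I x≢jx = Δ0-induction-≤ (CongruentMod2^-definable x≢jx) m
      (CongruentMod2^-zero x (j x))
      (λ k k<m → CongruentMod2^-suc (fixed (Ifix-down (inj₁ k<m) m∈I)))

    Exp-total : Nontrivial M j → ∀ {m} → I m → Σ C λ w → Exp m w
    Exp-total (c , jc≢c) {m} m∈I =
      let (w , ew , _) = CongruentMod2^-≤ m∈I (≢-sym jc≢c) m ≤-refl in w , ew

    Exp-∈Ifix : LEM → ∀ {m w} → I m → Exp m w → I w
    Exp-∈Ifix lem {m} {w} m∈I ew y y≤w with lem (j y ≡ y)
    ... | inj₁ jy≡y = jy≡y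
    ... | inj₂ jy≢y = ⊥-elim (<⇒≱ y+jy<w+w w+w≤y+jy)
      where
      jw≡w : j w ≡ w
      jw≡w = Exp-fixed (fixed m∈I) ew
      y<w : y < w
      y<w = ≤∧≢⇒< y≤w λ { refl → jy≢y jw≡w }
      y+jy<w+w : y + j y < w + w
      y+jy<w+w = +-mono-< y<w (j-<-fixed jw≡w y<w)
      w+w≤y+jy : w + w ≤ y + j y
      w+w≤y+jy = CongruentMod2^⇒≤+ (≢-sym jy≢y) (Exp-suc⁺ ew)
        (CongruentMod2^-≤ (+∈Ifix m∈I 1∈Ifix) (≢-sym jy≢y) (m + 1#) ≤-refl)

    Ifix-Exp : LEM → Nontrivial M j → ExpAx M E I
    Ifix-Exp lem nontrivial m m∈I =
      let (w , ew) = Exp-total nontrivial m∈I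
          w∈I = Exp-∈Ifix lem m∈I ew
      in w , w∈I , Absoluteness.Sat-abs⁻ Ifix-cut (proj₁ isE) (InD-∷ I m∈I (InD-∷ I w∈I λ ())) ew

theorem3p2 : LEM → (M : Str) → IΔ0 M (All M) →
    (j : Str.C M → Str.C M) → SelfEmbedding M j → Nontrivial M j →
    Δ0Elementary M j →
    (E : Fm 2) → IsExpFormula E →
    Closed M (Ifix M j) × IΔ0 M (Ifix M j) × BΣ1 M (Ifix M j) × ExpAx M E (Ifix M j)
theorem3p2 lem M iM j emb nontrivial elem E isE =
  IsCut.closed Ifix-cut , (PAminus-cut , IndΔ0-cut) , BΣ1-cut , Ifix-Exp elem E isE lem nontrivial
  where
  open FixedInitialSegment M iM emb
  open Cut M iM Ifix-cut
  open Proper lem (proj₂ (Ifix-proper nontrivial))
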